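{- Let $H$ be a connected interval $d$-uniform hypergraph ($d\ge 2$) on vertex set $[n]$. Then $\{1\}$ and $\{n\}$ are zero forcing sets for $H$.
   Context: An interval $d$-hypergraph here has vertex set $[n]$ and every edge is of the form $\{\ell,\ell+1,\dots,\ell+d-1\}$ for some $\ell\in\{1,\dots,n-d+1\}$. A path in a hypergraph is an alternating sequence $v_1,e_1,v_2,\dots,e_s,v_{s+1}$ of distinct vertices and distinct edges with $v_i,v_{i+1}\in e_i$; the hypergraph is connected if any two vertices are joined by a path. Zero forcing: with a set $B$ initially blue and the other vertices white, a set $S$ of $d-1$ distinct vertices (not necessarily blue) can turn a white vertex $w$ blue if $S\cup\{w\}$ is an edge and every white vertex $u$ such that $S\cup\{u\}$ is an edge satisfies $u=w$. $B$ is a zero forcing set if repeated application of this rule colors every vertex blue. -}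

module Defs where

open import Data.Nat using (ℕ; zero; suc; _+_; _∸_; _≤_; _<_)
open import Data.List using (List; []; _∷_; length)
open import Data.List.Membership.Propositional using (_∈_; _∉_)
open import Data.List.Relation.Unary.Unique.Propositional using (Unique)
open import Data.Product using (Σ; _×_; ∃)
open import Data.Sum using (_⊎_)
open import Relation.Binary.PropositionalEquality using (_≡_)

InV : ℕ → ℕ → Set
InV n v = 1 ≤ v × v ≤ n

-- An interval d-hypergraph on [n] is given by its set E of left endpoints ℓ;
-- ℓ stands for the edge {ℓ, ℓ+1, …, ℓ+d-1}, and ℓ ∈ {1, …, n-d+1}.
IntervalHypergraph : (n d : ℕ) → (E : ℕ → Set) → Set
IntervalHypergraph n d E = ∀ ℓ → E ℓ → 1 ≤ ℓ × ℓ + d ≤ suc n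

_∈[_,_] : ℕ → ℕ → ℕ → Set
v ∈[ ℓ , d ] = ℓ ≤ v × v < ℓ + d

data Path (E : ℕ → Set) (d : ℕ) : ℕ → ℕ → List ℕ → List ℕ → Set where
  trivial : ∀ v → Path E d v v (v ∷ []) []
  step : ∀ {u w vs es} ℓ v → E ℓ → v ∈[ ℓ , d ] → u ∈[ ℓ , d ] →
         Path E d u w vs es → Path E d v w (v ∷ vs) (ℓ ∷ es)

Connected : (n d : ℕ) → (E : ℕ → Set) → Set
Connected n d E = ∀ u w → InV n u → InV n w →
  Σ (List ℕ) λ vs → Σ (List ℕ) λ es →
    Path E d u w vs es × Unique vs × Unique es

IsEdge : (d : ℕ) → (E : ℕ → Set) → (ℕ → Set) → Set
IsEdge d E X = Σ ℕ λ ℓ → E ℓ × (∀ x → (X x → x ∈[ ℓ , d ]) × (x ∈[ ℓ , d ] → X x))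

Ins : List ℕ → ℕ → ℕ → Set
Ins S u x = x ∈ S ⊎ x ≡ u

White : ℕ → List ℕ → ℕ → Set
White n B u = InV n u × u ∉ B

Force : (n d : ℕ) → (E : ℕ → Set) → List ℕ → ℕ → Set
Force n d E B w = Σ (List ℕ) λ S →
  Unique S × length S ≡ d ∸ 1 × (∀ x → x ∈ S → InV n x) ×
  White n B w × IsEdge d E (Ins S w) ×
  (∀ u → White n B u → IsEdge d E (Ins S u) → u ≡ w)

data Forcing (n d : ℕ) (E : ℕ → Set) : List ℕ → List ℕ → Set where
  done : ∀ B → Forcing n d E B B
  next : ∀ {B B'} w → Force n d E B w → Forcing n d E (w ∷ B) B' → Forcing n d E B B'

ZeroForcingSet : (n d : ℕ) → (E : ℕ → Set) → List ℕ → Set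
ZeroForcingSet n d E B = Σ (List ℕ) λ B' → Forcing n d E B B' × (∀ v → InV n v → v ∈ B')

-- Suppose the blue vertices are exactly 1, …, k with k < n. A path from k to k + 1
-- must use an edge [ℓ, ℓ + d) containing both; let S be that edge without k + 1.
-- Since edges are intervals and ℓ ∈ S, S ∪ {u} is an edge only for u = k + 1 or
-- u < ℓ, and the latter vertices are blue. So S forces k + 1, and sweeping upwards
-- from {1} colours all of [n]. The mirror argument sweeps downwards from {n}.
module Submission where

open import Defs
open import Data.Nat using (ℕ; zero; suc; _+_; _∸_; _≤_; _<_; s≤s; z<s; _≟_; _≤?_)
open import Data.Nat.Properties
open import Data.List using (List; []; _∷_; _++_; length; applyUpTo)
open import Data.List.Properties using (length-++; length-applyUpTo)
open import Data.List.Membership.Propositional using (_∈_; _∉_)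
open import Data.List.Membership.Propositional.Properties
  using (∈-++⁺ˡ; ∈-++⁺ʳ; ∈-++⁻; ∈-applyUpTo⁺; ∈-applyUpTo⁻)
open import Data.List.Relation.Unary.Any using (here; there)
open import Data.List.Relation.Unary.Unique.Propositional using (Unique)
open import Data.List.Relation.Unary.Unique.Propositional.Properties using (++⁺; applyUpTo⁺₁)
open import Data.Product using (Σ; _×_; _,_; proj₁; proj₂)
open import Data.Empty using (⊥)
open import Data.Sum using (_⊎_; inj₁; inj₂)
open import Function.Bundles using (_⇔_; mk⇔; Equivalence)
open import Relation.Nullary using (yes; no; contradiction)
open import Relation.Binary.PropositionalEquality
open import Relation.Binary.Definitions using (tri<; tri≈; tri>)

range : ℕ → ℕ → List ℕ
range a m = applyUpTo (a +_) m

∈-range⁻ : ∀ {x a m} → x ∈ range a m → x ∈[ a , m ]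
∈-range⁻ {a = a} p with i , i<m , refl ← ∈-applyUpTo⁻ (a +_) p = m≤m+n a i , +-monoʳ-< a i<m

∈-range⁺ : ∀ {x a m} → x ∈[ a , m ] → x ∈ range a m
∈-range⁺ {x} {a} (a≤x , x<a+m) =
  subst (_∈ range a _) a+[x∸a]≡x (∈-applyUpTo⁺ (a +_) (+-cancelˡ-< a _ _ a+[x∸a]<a+m))
  where
  a+[x∸a]≡x : a + (x ∸ a) ≡ x
  a+[x∸a]≡x = m+[n∸m]≡n a≤x
  a+[x∸a]<a+m : a + (x ∸ a) < a + _
  a+[x∸a]<a+m = subst (_< a + _) (sym a+[x∸a]≡x) x<a+m

range-unique : ∀ a m → Unique (range a m)
range-unique a m = applyUpTo⁺₁ (a +_) m (λ i<j _ → <⇒≢ (+-monoʳ-< a i<j))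

length-range : ∀ a m → length (range a m) ≡ m
length-range a = length-applyUpTo (a +_)

edgeWithout : ℕ → ℕ → ℕ → List ℕ
edgeWithout d ℓ s = range ℓ (s ∸ ℓ) ++ range (suc s) (ℓ + d ∸ suc s)

module _ {d ℓ s : ℕ} (ℓ≤s : ℓ ≤ s) (s<ℓ+d : s < ℓ + d) where

  private
    S : List ℕ
    S = edgeWithout d ℓ s

    below-s : ℓ + (s ∸ ℓ) ≡ s
    below-s = m+[n∸m]≡n ℓ≤s

    above-s : suc s + (ℓ + d ∸ suc s) ≡ ℓ + d
    above-s = m+[n∸m]≡n s<ℓ+d

    ℓ<ℓ+d : ℓ < ℓ + d
    ℓ<ℓ+d = ≤-<-trans ℓ≤s s<ℓ+d

    0<d : 0 < d
    0<d = +-cancelˡ-< ℓ 0 d (subst (_< ℓ + d) (sym (+-identityʳ ℓ)) ℓ<ℓ+d)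

  ∈-edgeWithout⁻ : ∀ {x} → x ∈ S → x ∈[ ℓ , d ] × x ≢ s
  ∈-edgeWithout⁻ {x} p with ∈-++⁻ (range ℓ (s ∸ ℓ)) p
  ... | inj₁ q with ℓ≤x , x<s′ ← ∈-range⁻ q =
    let x<s = subst (x <_) below-s x<s′ in (ℓ≤x , <-trans x<s s<ℓ+d) , <⇒≢ x<s
  ... | inj₂ q with s<x , x<ℓ+d ← ∈-range⁻ q =
    (≤-trans ℓ≤s (<⇒≤ s<x) , subst (x <_) above-s x<ℓ+d) , >⇒≢ s<x

  ∈-edgeWithout⁺ : ∀ {x} → x ∈[ ℓ , d ] → x ≢ s → x ∈ S
  ∈-edgeWithout⁺ {x} (ℓ≤x , x<ℓ+d) x≢s with <-cmp x s
  ... | tri< x<s _ _ = ∈-++⁺ˡ (∈-range⁺ (ℓ≤x , subst (x <_) (sym below-s) x<s))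
  ... | tri≈ _ x≡s _ = contradiction x≡s x≢s
  ... | tri> _ _ s<x = ∈-++⁺ʳ _ (∈-range⁺ (s<x , subst (x <_) (sym above-s) x<ℓ+d))

  edgeWithout-unique : Unique S
  edgeWithout-unique = ++⁺ (range-unique ℓ _) (range-unique (suc s) _) disjoint
    where
    disjoint : ∀ {x} → x ∈ range ℓ (s ∸ ℓ) × x ∈ range (suc s) (ℓ + d ∸ suc s) → ⊥
    disjoint {x} (p , q) =
      <-asym (subst (x <_) below-s (proj₂ (∈-range⁻ p))) (proj₁ (∈-range⁻ q))

  length-edgeWithout : length S ≡ d ∸ 1
  length-edgeWithout = begin
    length S                                       ≡⟨ length-++ (range ℓ a) ⟩
    length (range ℓ a) + length (range (suc s) b)  ≡⟨ cong₂ _+_ (length-range ℓ a) (length-range (suc s) b) ⟩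
    a + b                                          ≡⟨ cong (_∸ 1) (+-cancelˡ-≡ ℓ (suc (a + b)) d sizes) ⟩
    d ∸ 1                                          ∎
    where
    open ≡-Reasoning
    a b : ℕ
    a = s ∸ ℓ
    b = ℓ + d ∸ suc s
    sizes : ℓ + suc (a + b) ≡ ℓ + d
    sizes = begin
      ℓ + suc (a + b)   ≡⟨ +-suc ℓ (a + b) ⟩
      suc (ℓ + (a + b)) ≡⟨ cong suc (sym (+-assoc ℓ a b)) ⟩
      suc (ℓ + a + b)   ≡⟨ cong (λ t → suc (t + b)) below-s ⟩
      suc s + b         ≡⟨ above-s ⟩
      ℓ + d             ∎

  edgeWithout-completes : ∀ {E} → E ℓ → IsEdge d E (Ins S s)
  edgeWithout-completes e = ℓ , e , λ x → into x , onto x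
    where
    into : ∀ x → Ins S s x → x ∈[ ℓ , d ]
    into x (inj₁ x∈S) = proj₁ (∈-edgeWithout⁻ x∈S)
    into x (inj₂ refl) = ℓ≤s , s<ℓ+d
    onto : ∀ x → x ∈[ ℓ , d ] → Ins S s x
    onto x x∈ with x ≟ s
    ... | yes x≡s = inj₂ x≡s
    ... | no x≢s = inj₁ (∈-edgeWithout⁺ x∈ x≢s)

  completion-same-edge : ∀ {u} → (∀ x → x ∈[ ℓ , d ] → Ins S u x) → u ≡ s
  completion-same-edge covers with covers s (ℓ≤s , s<ℓ+d)
  ... | inj₁ s∈S = contradiction refl (proj₂ (∈-edgeWithout⁻ s∈S))
  ... | inj₂ s≡u = sym s≡u

  completion-below : ∀ {E u} → ℓ < s → IsEdge d E (Ins S u) → u ≡ s ⊎ u < ℓ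
  completion-below ℓ<s (ℓ′ , _ , edge) with m≤n⇒m<n∨m≡n ℓ′≤ℓ
    where
    ℓ′≤ℓ : ℓ′ ≤ ℓ
    ℓ′≤ℓ = proj₁ (proj₁ (edge ℓ) (inj₁ (∈-edgeWithout⁺ (≤-refl , ℓ<ℓ+d) (<⇒≢ ℓ<s))))
  ... | inj₂ refl = inj₁ (completion-same-edge (λ x → proj₂ (edge x)))
  ... | inj₁ ℓ′<ℓ with proj₂ (edge ℓ′) (≤-refl , m<m+n ℓ′ 0<d)
  ...   | inj₁ ℓ′∈S = contradiction (proj₁ (proj₁ (∈-edgeWithout⁻ ℓ′∈S))) (<⇒≱ ℓ′<ℓ)
  ...   | inj₂ refl = inj₂ ℓ′<ℓ

  -- The top vertex ℓ + d ∸ 1 of the edge plays the role ℓ plays in completion-below.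
  completion-above : ∀ {E u} → suc s < ℓ + d → IsEdge d E (Ins S u) → u ≡ s ⊎ ℓ + d ≤ u
  completion-above 1+s<ℓ+d (ℓ′ , _ , edge) with m≤n⇒m<n∨m≡n ℓ≤ℓ′
    where
    top : ℕ
    top = ℓ + d ∸ 1
    suc-top : suc top ≡ ℓ + d
    suc-top = trans (+-comm 1 top) (m∸n+n≡m (≤-trans z<s s<ℓ+d))
    s<top : s < top
    s<top = ≤-pred (subst (suc s <_) (sym suc-top) 1+s<ℓ+d)
    top∈S : top ∈ S
    top∈S = ∈-edgeWithout⁺ (≤-trans ℓ≤s (<⇒≤ s<top) , subst (top <_) suc-top (n<1+n top))
                            (>⇒≢ s<top)
    ℓ≤ℓ′ : ℓ ≤ ℓ′
    ℓ≤ℓ′ = +-cancelʳ-≤ d ℓ ℓ′ (subst (_≤ ℓ′ + d) suc-top (proj₂ (proj₁ (edge top) (inj₁ top∈S))))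
  ... | inj₂ refl = inj₁ (completion-same-edge (λ x → proj₂ (edge x)))
  ... | inj₁ ℓ<ℓ′ with proj₂ (edge (ℓ + d)) (ℓ′≤ℓ+d , +-monoˡ-< d ℓ<ℓ′)
    where
    ℓ′≤ℓ+d : ℓ′ ≤ ℓ + d
    ℓ′≤ℓ+d = ≤-trans (proj₁ (proj₁ (edge (suc s)) (inj₁ 1+s∈S))) (<⇒≤ 1+s<ℓ+d)
      where
      1+s∈S : suc s ∈ S
      1+s∈S = ∈-edgeWithout⁺ (≤-trans ℓ≤s (n≤1+n s) , 1+s<ℓ+d) (1+n≢n)
  ...   | inj₁ ℓ+d∈S = contradiction (proj₂ (proj₁ (∈-edgeWithout⁻ ℓ+d∈S))) (<-irrefl refl)
  ...   | inj₂ refl = inj₂ ≤-refl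

InV-edge : ∀ {n d E ℓ x} → IntervalHypergraph n d E → E ℓ → x ∈[ ℓ , d ] → InV n x
InV-edge interval e (ℓ≤x , x<ℓ+d) with 1≤ℓ , ℓ+d≤1+n ← interval _ e =
  ≤-trans 1≤ℓ ℓ≤x , ≤-pred (<-≤-trans x<ℓ+d ℓ+d≤1+n)

force-by-edge : ∀ {n d E B ℓ s} → IntervalHypergraph n d E → E ℓ →
  (ℓ≤s : ℓ ≤ s) (s<ℓ+d : s < ℓ + d) → White n B s →
  (∀ u → White n B u → IsEdge d E (Ins (edgeWithout d ℓ s) u) → u ≡ s) →
  Force n d E B s
force-by-edge {d = d} {ℓ = ℓ} {s} interval e ℓ≤s s<ℓ+d white pinned =
  edgeWithout d ℓ s , edgeWithout-unique {d} ℓ≤s s<ℓ+d , length-edgeWithout ℓ≤s s<ℓ+d ,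
  (λ x x∈S → InV-edge interval e (proj₁ (∈-edgeWithout⁻ ℓ≤s s<ℓ+d x∈S))) ,
  white , edgeWithout-completes ℓ≤s s<ℓ+d e , pinned

path-edge-across : ∀ {E d u w vs es} k → Path E d u w vs es → u ≤ k → k < w →
  Σ ℕ λ ℓ → E ℓ × ℓ ≤ k × suc k < ℓ + d
path-edge-across k (trivial _) u≤k k<u = contradiction u≤k (<⇒≱ k<u)
path-edge-across k (step {u = u′} ℓ _ e (ℓ≤v , _) (_ , u′<ℓ+d) path) v≤k k<w with u′ ≤? k
... | yes u′≤k = path-edge-across k path u′≤k k<w
... | no u′≰k = ℓ , e , ≤-trans ℓ≤v v≤k , ≤-<-trans (≰⇒> u′≰k) u′<ℓ+d

consecutive-edge : ∀ {n d E k} → Connected n d E → 1 ≤ k → k < n →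
  Σ ℕ λ ℓ → E ℓ × ℓ ≤ k × suc k < ℓ + d
consecutive-edge {k = k} connected 1≤k k<n
  with _ , _ , path , _ ← connected k (suc k) (1≤k , <⇒≤ k<n) (z<s , k<n) =
  path-edge-across k path ≤-refl (n<1+n k)

IsSegment : List ℕ → ℕ → ℕ → Set
IsSegment B a b = ∀ x → x ∈ B ⇔ (a ≤ x × x ≤ b)

segment-singleton : ∀ a → IsSegment (a ∷ []) a a
segment-singleton a x = mk⇔ (λ { (here refl) → ≤-refl , ≤-refl })
                            (λ (a≤x , x≤a) → here (≤-antisym x≤a a≤x))

segment-extendʳ : ∀ {B a b} → IsSegment B a b → a ≤ suc b → IsSegment (suc b ∷ B) a (suc b)
segment-extendʳ {B} {a} {b} seg a≤1+b x = mk⇔ to from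
  where
  to : x ∈ suc b ∷ B → a ≤ x × x ≤ suc b
  to (here refl) = a≤1+b , ≤-refl
  to (there x∈B) with a≤x , x≤b ← Equivalence.to (seg x) x∈B = a≤x , m≤n⇒m≤1+n x≤b
  from : a ≤ x × x ≤ suc b → x ∈ suc b ∷ B
  from (a≤x , x≤1+b) with m≤n⇒m<n∨m≡n x≤1+b
  ... | inj₁ x<1+b = there (Equivalence.from (seg x) (a≤x , ≤-pred x<1+b))
  ... | inj₂ x≡1+b = here x≡1+b

segment-extendˡ : ∀ {B a b} → IsSegment B (suc a) b → a ≤ b → IsSegment (a ∷ B) a b
segment-extendˡ {B} {a} {b} seg a≤b x = mk⇔ to from
  where
  to : x ∈ a ∷ B → a ≤ x × x ≤ b
  to (here refl) = ≤-refl , a≤b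
  to (there x∈B) with a<x , x≤b ← Equivalence.to (seg x) x∈B = <⇒≤ a<x , x≤b
  from : a ≤ x × x ≤ b → x ∈ a ∷ B
  from (a≤x , x≤b) with m≤n⇒m<n∨m≡n a≤x
  ... | inj₁ a<x = there (Equivalence.from (seg x) (a<x , x≤b))
  ... | inj₂ a≡x = here (sym a≡x)

∉-segment-above : ∀ {B a b x} → IsSegment B a b → b < x → x ∉ B
∉-segment-above {x = x} seg b<x x∈B = <⇒≱ b<x (proj₂ (Equivalence.to (seg x) x∈B))

∉-segment-below : ∀ {B a b x} → IsSegment B a b → x < a → x ∉ B
∉-segment-below {x = x} seg x<a x∈B = <⇒≱ x<a (proj₁ (Equivalence.to (seg x) x∈B))

segment-gap-above : ∀ {B a b u} → IsSegment B a b → a ≤ u → u ∉ B → b < u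
segment-gap-above {u = u} seg a≤u u∉B = ≰⇒> (λ u≤b → u∉B (Equivalence.from (seg u) (a≤u , u≤b)))

segment-gap-below : ∀ {B a b u} → IsSegment B a b → u ≤ b → u ∉ B → u < a
segment-gap-below {u = u} seg u≤b u∉B = ≰⇒> (λ a≤u → u∉B (Equivalence.from (seg u) (a≤u , u≤b)))

ZeroForcingSet-step : ∀ {n d E B w} → Force n d E B w → ZeroForcingSet n d E (w ∷ B) →
  ZeroForcingSet n d E B
ZeroForcingSet-step force (B′ , forcing , covered) = B′ , next _ force forcing , covered

ZeroForcingSet-segment : ∀ {n d E B} → IsSegment B 1 n → ZeroForcingSet n d E B
ZeroForcingSet-segment {B = B} seg = B , done B , λ v → Equivalence.from (seg v)

ZeroForcingSet-empty : ∀ {d E B} → ZeroForcingSet 0 d E B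
ZeroForcingSet-empty {B = B} = B , done B , λ _ (1≤v , v≤0) → contradiction v≤0 (<⇒≱ 1≤v)

module Sweep {n d : ℕ} {E : ℕ → Set} (interval : IntervalHypergraph n d E)
             (connected : Connected n d E) where

  force-up : ∀ {B k} → IsSegment B 1 k → 1 ≤ k → k < n → Force n d E B (suc k)
  force-up {B} {k} seg 1≤k k<n with ℓ , e , ℓ≤k , 1+k<ℓ+d ← consecutive-edge connected 1≤k k<n =
    force-by-edge interval e (m≤n⇒m≤1+n ℓ≤k) 1+k<ℓ+d
      ((z<s , k<n) , ∉-segment-above seg (n<1+n k)) pinned
    where
    pinned : ∀ u → White n B u → IsEdge d E (Ins (edgeWithout d ℓ (suc k)) u) → u ≡ suc k
    pinned u ((1≤u , _) , u∉B) edge with completion-below (m≤n⇒m≤1+n ℓ≤k) 1+k<ℓ+d (s≤s ℓ≤k) edge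
    ... | inj₁ u≡1+k = u≡1+k
    ... | inj₂ u<ℓ = contradiction (segment-gap-above seg 1≤u u∉B) (≤⇒≯ (≤-trans (<⇒≤ u<ℓ) ℓ≤k))

  force-down : ∀ {B j} → IsSegment B (suc j) n → 1 ≤ j → j < n → Force n d E B j
  force-down {B} {j} seg 1≤j j<n with ℓ , e , ℓ≤j , 1+j<ℓ+d ← consecutive-edge connected 1≤j j<n =
    force-by-edge interval e ℓ≤j j<ℓ+d ((1≤j , <⇒≤ j<n) , ∉-segment-below seg (n<1+n j)) pinned
    where
    j<ℓ+d : j < ℓ + d
    j<ℓ+d = <-trans (n<1+n j) 1+j<ℓ+d
    pinned : ∀ u → White n B u → IsEdge d E (Ins (edgeWithout d ℓ j) u) → u ≡ j
    pinned u ((_ , u≤n) , u∉B) edge with completion-above ℓ≤j j<ℓ+d 1+j<ℓ+d edge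
    ... | inj₁ u≡j = u≡j
    ... | inj₂ ℓ+d≤u =
      contradiction (≤-trans ℓ+d≤u (≤-pred (segment-gap-below seg u≤n u∉B))) (<⇒≱ j<ℓ+d)

  sweep-up : ∀ m {B k} → k + m ≡ n → 1 ≤ k → IsSegment B 1 k → ZeroForcingSet n d E B
  sweep-up zero {B} k+0≡n _ seg =
    ZeroForcingSet-segment (subst (IsSegment B 1) (trans (sym (+-identityʳ _)) k+0≡n) seg)
  sweep-up (suc m) {k = k} k+1+m≡n 1≤k seg =
    ZeroForcingSet-step (force-up seg 1≤k (subst (k <_) k+1+m≡n (m<m+n k z<s)))
      (sweep-up m (trans (sym (+-suc k m)) k+1+m≡n) z<s (segment-extendʳ seg (m≤n⇒m≤1+n 1≤k)))

  sweep-down : ∀ j {B} → j < n → IsSegment B (suc j) n → ZeroForcingSet n d E B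
  sweep-down zero _ seg = ZeroForcingSet-segment seg
  sweep-down (suc i) 1+i<n seg =
    ZeroForcingSet-step (force-down seg z<s 1+i<n)
      (sweep-down i (<-trans (n<1+n i) 1+i<n) (segment-extendˡ seg (<⇒≤ 1+i<n)))

lemma3p7 : (n d : ℕ) → (E : ℕ → Set) → 2 ≤ d →
    IntervalHypergraph n d E → Connected n d E →
    ZeroForcingSet n d E (1 ∷ []) × ZeroForcingSet n d E (n ∷ [])
lemma3p7 zero d E _ _ _ = ZeroForcingSet-empty , ZeroForcingSet-empty
lemma3p7 (suc n) d E _ interval connected =
  sweep-up n refl z<s (segment-singleton 1) , sweep-down n (n<1+n n) (segment-singleton (suc n))
  where open Sweep interval connected
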